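{- For $n\ge 0$, $\left|\mathcal{S}^2_n(213)\right|=a_n$, where $a_n$ is the number of lattice paths from $(0,0)$ to $(4n,0)$ using steps $(1,3)$, $(2,2)$ and $(1,-1)$ that stay weakly above the $x$-axis.
   Context: $\mathcal{S}^2_n(P)$ denotes the set of permutations $\pi\in\mathcal{S}_{3n}$ that avoid every pattern in $P$ (classical pattern avoidance) and satisfy $\pi_{3i+1}<\pi_{3i+2}$ and $\pi_{3i+1}<\pi_{3i+3}$ for all $0\le i<n$. -}

module Defs where

open import Data.Bool using (Bool; true; false; _∧_; _∨_; not; T)
open import Data.Nat using (ℕ; zero; suc; _+_; _*_; _<ᵇ_; _≡ᵇ_)
open import Data.List using (List; []; _∷_; length)
open import Data.Bool.ListAction using (any; all)
open import Data.Product using (Σ)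

-- Words are lists of naturals; a permutation in S_m is a list of the
-- values 0,1,...,m-1 (0-based values), each appearing exactly once.

elemᵇ : ℕ → List ℕ → Bool
elemᵇ x []       = false
elemᵇ x (y ∷ ys) = (x ≡ᵇ y) ∨ elemᵇ x ys

distinctᵇ : List ℕ → Bool
distinctᵇ []       = true
distinctᵇ (x ∷ xs) = not (elemᵇ x xs) ∧ distinctᵇ xs

isPermᵇ : ℕ → List ℕ → Bool
isPermᵇ m w = (length w ≡ᵇ m) ∧ (all (λ x → x <ᵇ m) w ∧ distinctᵇ w)

occ213From : ℕ → List ℕ → Bool
occ213From x []       = false
occ213From x (y ∷ ys) = ((y <ᵇ x) ∧ any (λ z → x <ᵇ z) ys) ∨ occ213From x ys

contains213 : List ℕ → Bool
contains213 []       = false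
contains213 (x ∷ xs) = occ213From x xs ∨ contains213 xs

blocksOKᵇ : List ℕ → Bool
blocksOKᵇ []                = true
blocksOKᵇ (a ∷ b ∷ c ∷ rest) = (a <ᵇ b) ∧ (a <ᵇ c) ∧ blocksOKᵇ rest
blocksOKᵇ _                 = false

inS2-213 : ℕ → List ℕ → Bool
inS2-213 n w = isPermᵇ (3 * n) w ∧ (not (contains213 w) ∧ blocksOKᵇ w)

S2-213 : ℕ → Set
S2-213 n = Σ (List ℕ) (λ w → T (inS2-213 n w))

data Step : Set where
  up13   : Step
  up22   : Step
  down11 : Step

xlen : List Step → ℕ
xlen []            = 0
xlen (up13 ∷ s)    = 1 + xlen s
xlen (up22 ∷ s)    = 2 + xlen s
xlen (down11 ∷ s)  = 1 + xlen s

aboveEndsZeroᵇ : ℕ → List Step → Bool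
aboveEndsZeroᵇ h []                  = h ≡ᵇ 0
aboveEndsZeroᵇ h (up13 ∷ s)          = aboveEndsZeroᵇ (h + 3) s
aboveEndsZeroᵇ h (up22 ∷ s)          = aboveEndsZeroᵇ (h + 2) s
aboveEndsZeroᵇ zero (down11 ∷ s)     = false
aboveEndsZeroᵇ (suc h) (down11 ∷ s)  = aboveEndsZeroᵇ h s

isPathᵇ : ℕ → List Step → Bool
isPathᵇ n s = (xlen s ≡ᵇ 4 * n) ∧ aboveEndsZeroᵇ 0 s

Paths : ℕ → Set
Paths n = Σ (List Step) (λ s → T (isPathᵇ n s))

module Submission where

-- |S²ₙ(213)| = aₙ, proved by composing two explicit bijections through a
-- family of plane trees whose internal nodes have four or three children
-- (`Tree`; the size of a tree is its number of internal nodes).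
--
-- The preorder code of a tree, with (1,3) for a 4-node, (2,2) for a
-- 3-node and (1,-1) for a leaf, minus its final step, is a lattice path of
-- x-length 4·size that stays weakly above the axis; parsing from the right
-- with a stack of trees inverts it (`paths↔trees`).
--
-- A nonempty 213-avoiding permutation w = A ++ 0 ∷ B has every
-- entry of A above every entry of B, so w = glue X Y for two smaller such
-- permutations (`glued-at-zero`, using a pigeonhole count).  The block
-- condition forces the 0 to start a block unless it falls among the first
-- one or two entries still owed to an earlier block; tracking that offset,
-- the recursion unfolds into an encoding `build` of trees as words of length
-- 3·size.

open import Defs
open import Data.Bool using (Bool; true; false; not; _∧_; _∨_; T)
open import Data.Bool.Properties using (T-irrelevant; T-∧; T-∨)
open import Data.Bool.ListAction using (any; all)
open import Data.Empty using (⊥-elim)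
open import Data.Unit using (⊤; tt)
open import Data.Nat using (ℕ; zero; suc; _+_; _*_; _∸_; _<_; _≤_; _≤?_; _<?_; _≟_; _<ᵇ_; _≡ᵇ_; s≤s; z≤n)
open import Data.Nat.Properties
open import Data.Nat.Tactic.RingSolver using (solve-∀)
open import Data.List using (List; []; _∷_; _++_; length; map)
open import Data.List.Properties using (++-assoc; ++-cancelʳ; ++-identityʳ; length-++; length-map)
open import Data.List.Membership.Propositional using (_∈_)
open import Data.List.Membership.Propositional.Properties using (∈-∃++)
open import Data.List.Membership.DecPropositional _≟_ using (_∈?_)
open import Data.List.Relation.Unary.All as All using (All; []; _∷_)
import Data.List.Relation.Unary.All.Properties as AllP
open import Data.List.Relation.Unary.Any as Any using (there)
import Data.List.Relation.Unary.Any.Properties as AnyP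
open import Data.List.Relation.Unary.Unique.Propositional as U using (Unique; []; _∷_)
import Data.List.Relation.Unary.Unique.Propositional.Properties as UniqueP
open import Data.Maybe using (Maybe; just; nothing)
open import Data.Product using (Σ; Σ-syntax; _,_; proj₁; proj₂; _×_)
open import Data.Sum using (_⊎_; inj₁; inj₂)
open import Function.Bundles using (_↔_; mk↔ₛ′; Equivalence)
open import Function.Properties.Inverse using (↔-trans; ↔-sym)
open import Relation.Nullary using (¬_; yes; no)
open import Relation.Binary.PropositionalEquality
  using (_≡_; _≢_; refl; sym; trans; cong; cong₂; subst; ≢-sym; module ≡-Reasoning)

data Tree : Set where
  leaf  : Tree
  node₄ : Tree → Tree → Tree → Tree → Tree
  node₃ : Tree → Tree → Tree → Tree

size : Tree → ℕ
size leaf            = 0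
size (node₄ a b c d) = suc (size a + size b + size c + size d)
size (node₃ a b c)   = suc (size a + size b + size c)

TreeOfSize : ℕ → Set
TreeOfSize n = Σ[ t ∈ Tree ] size t ≡ n

Σ-T-≡ : ∀ {A : Set} {P : A → Bool} {x y : A} (p : T (P x)) (q : T (P y)) →
        x ≡ y → _≡_ {A = Σ A (λ a → T (P a))} (x , p) (y , q)
Σ-T-≡ p q refl = cong (_ ,_) (T-irrelevant p q)

Σ-size-≡ : ∀ {n} {s t : Tree} (p : size s ≡ n) (q : size t ≡ n) →
           s ≡ t → _≡_ {A = TreeOfSize n} (s , p) (t , q)
Σ-size-≡ p q refl = cong (_ ,_) (≡-irrelevant p q)

-- The preorder (Łukasiewicz) code: (1,3) for a node₄, (2,2) for a node₃
-- and (1,-1) for a leaf.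
code : Tree → List Step
code leaf            = down11 ∷ []
code (node₄ a b c d) = up13 ∷ (code a ++ code b ++ code c ++ code d)
code (node₃ a b c)   = up22 ∷ (code a ++ code b ++ code c)

path : Tree → List Step
path leaf            = []
path (node₄ a b c d) = up13 ∷ (code a ++ code b ++ code c ++ path d)
path (node₃ a b c)   = up22 ∷ (code a ++ code b ++ path c)

code≡path∷down : ∀ t → code t ≡ path t ++ down11 ∷ []
code≡path∷down leaf = refl
code≡path∷down (node₄ a b c d) rewrite code≡path∷down d
  | ++-assoc (code a) (code b ++ code c ++ path d) (down11 ∷ [])
  | ++-assoc (code b) (code c ++ path d) (down11 ∷ [])
  | ++-assoc (code c) (path d) (down11 ∷ []) = refl
code≡path∷down (node₃ a b c) rewrite code≡path∷down c
  | ++-assoc (code a) (code b ++ path c) (down11 ∷ [])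
  | ++-assoc (code b) (path c) (down11 ∷ []) = refl

-- Along a code the height drops by exactly one overall and never goes
-- below its final value.
height-code : ∀ h t s → aboveEndsZeroᵇ (suc h) (code t ++ s) ≡ aboveEndsZeroᵇ h s
height-code h leaf s = refl
height-code h (node₄ a b c d) s
  rewrite +-comm h 3
        | ++-assoc (code a) (code b ++ code c ++ code d) s
        | ++-assoc (code b) (code c ++ code d) s
        | ++-assoc (code c) (code d) s
        | height-code (suc (suc (suc h))) a (code b ++ code c ++ code d ++ s)
        | height-code (suc (suc h)) b (code c ++ code d ++ s)
        | height-code (suc h) c (code d ++ s)
        | height-code h d s = refl
height-code h (node₃ a b c) s
  rewrite +-comm h 2
        | ++-assoc (code a) (code b ++ code c) s
        | ++-assoc (code b) (code c) s
        | height-code (suc (suc h)) a (code b ++ code c ++ s)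
        | height-code (suc h) b (code c ++ s)
        | height-code h c s = refl

path-valid : ∀ t → T (aboveEndsZeroᵇ 0 (path t))
path-valid leaf = _
path-valid (node₄ a b c d)
  rewrite height-code 2 a (code b ++ code c ++ path d)
        | height-code 1 b (code c ++ path d)
        | height-code 0 c (path d) = path-valid d
path-valid (node₃ a b c)
  rewrite height-code 1 a (code b ++ path c)
        | height-code 0 b (path c) = path-valid c

xlen-++ : ∀ xs ys → xlen (xs ++ ys) ≡ xlen xs + xlen ys
xlen-++ []            ys = refl
xlen-++ (up13 ∷ xs)   ys = cong suc (xlen-++ xs ys)
xlen-++ (up22 ∷ xs)   ys = cong (λ z → suc (suc z)) (xlen-++ xs ys)
xlen-++ (down11 ∷ xs) ys = cong suc (xlen-++ xs ys)

xlen-code : ∀ t → xlen (code t) ≡ suc (4 * size t)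
xlen-path : ∀ t → xlen (path t) ≡ 4 * size t
xlen-code t rewrite code≡path∷down t | xlen-++ (path t) (down11 ∷ []) | xlen-path t =
  +-comm (4 * size t) 1
xlen-path leaf = refl
xlen-path (node₄ a b c d)
  rewrite xlen-++ (code a) (code b ++ code c ++ path d)
        | xlen-++ (code b) (code c ++ path d)
        | xlen-++ (code c) (path d)
        | xlen-code a | xlen-code b | xlen-code c | xlen-path d =
  arith (size a) (size b) (size c) (size d)
  where
  arith : ∀ a b c d → suc (suc (4 * a) + (suc (4 * b) + (suc (4 * c) + 4 * d)))
                    ≡ 4 * suc (a + b + c + d)
  arith = solve-∀
xlen-path (node₃ a b c)
  rewrite xlen-++ (code a) (code b ++ path c)
        | xlen-++ (code b) (path c)
        | xlen-code a | xlen-code b | xlen-path c = arith (size a) (size b) (size c)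
  where
  arith : ∀ a b c → suc (suc (suc (4 * a) + (suc (4 * b) + 4 * c))) ≡ 4 * suc (a + b + c)
  arith = solve-∀

-- Decoding reads a step list from the right, keeping a stack of the trees
-- already decoded: a (1,-1) pushes a leaf, a (1,3) or (2,2) combines the
-- top four or three trees into a node.
push : Step → Maybe (List Tree) → Maybe (List Tree)
push _      nothing                        = nothing
push down11 (just st)                      = just (leaf ∷ st)
push up13   (just (a ∷ b ∷ c ∷ d ∷ st))    = just (node₄ a b c d ∷ st)
push up13   (just _)                       = nothing
push up22   (just (a ∷ b ∷ c ∷ st))        = just (node₃ a b c ∷ st)
push up22   (just _)                       = nothing

parse : List Step → Maybe (List Tree) → Maybe (List Tree)
parse []      m = m
parse (x ∷ s) m = push x (parse s m)

parse-++ : ∀ xs ys m → parse (xs ++ ys) m ≡ parse xs (parse ys m)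
parse-++ []       ys m = refl
parse-++ (x ∷ xs) ys m = cong (push x) (parse-++ xs ys m)

parse-code : ∀ t st → parse (code t) (just st) ≡ just (t ∷ st)
parse-code leaf st = refl
parse-code (node₄ a b c d) st
  rewrite parse-++ (code a) (code b ++ code c ++ code d) (just st)
        | parse-++ (code b) (code c ++ code d) (just st)
        | parse-++ (code c) (code d) (just st)
        | parse-code d st | parse-code c (d ∷ st) | parse-code b (c ∷ d ∷ st)
        | parse-code a (b ∷ c ∷ d ∷ st) = refl
parse-code (node₃ a b c) st
  rewrite parse-++ (code a) (code b ++ code c) (just st)
        | parse-++ (code b) (code c) (just st)
        | parse-code c st | parse-code b (c ∷ st)
        | parse-code a (b ∷ c ∷ st) = refl

-- The stack [leaf] plays the role of the dropped final (1,-1).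
parse-path : ∀ t → parse (path t) (just (leaf ∷ [])) ≡ just (t ∷ [])
parse-path t = begin
  parse (path t) (parse (down11 ∷ []) (just [])) ≡⟨ parse-++ (path t) (down11 ∷ []) (just []) ⟨
  parse (path t ++ down11 ∷ []) (just [])        ≡⟨ cong (λ s → parse s (just [])) (code≡path∷down t) ⟨
  parse (code t) (just [])                       ≡⟨ parse-code t [] ⟩
  just (t ∷ [])                                  ∎
  where open ≡-Reasoning

codes : List Tree → List Step
codes []       = []
codes (t ∷ ts) = code t ++ codes ts

parse-sound : ∀ s st st' → parse s (just st) ≡ just st' → codes st' ≡ s ++ codes st
parse-sound []      st .st refl = refl
parse-sound (x ∷ s) st st' eq with parse s (just st) in e
parse-sound (down11 ∷ s) st .(leaf ∷ r) refl | just r =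
  cong (down11 ∷_) (parse-sound s st r e)
parse-sound (up13 ∷ s) st .(node₄ a b c d ∷ r) refl | just (a ∷ b ∷ c ∷ d ∷ r) =
  cong (up13 ∷_) (trans (reassoc (code a) (code b) (code c) (code d) (codes r))
                        (parse-sound s st (a ∷ b ∷ c ∷ d ∷ r) e))
  where
  reassoc : ∀ (p q u v w : List Step) → (p ++ q ++ u ++ v) ++ w ≡ p ++ q ++ u ++ v ++ w
  reassoc p q u v w rewrite ++-assoc p (q ++ u ++ v) w | ++-assoc q (u ++ v) w
                          | ++-assoc u v w = refl
parse-sound (up22 ∷ s) st .(node₃ a b c ∷ r) refl | just (a ∷ b ∷ c ∷ r) =
  cong (up22 ∷_) (trans (reassoc (code a) (code b) (code c) (codes r))
                        (parse-sound s st (a ∷ b ∷ c ∷ r) e))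
  where
  reassoc : ∀ (p q u w : List Step) → (p ++ q ++ u) ++ w ≡ p ++ q ++ u ++ w
  reassoc p q u w rewrite ++-assoc p (q ++ u) w | ++-assoc q u w = refl

parse-complete : ∀ h s x xs → T (aboveEndsZeroᵇ h s) →
  Σ[ st ∈ List Tree ] parse s (just (x ∷ xs)) ≡ just st × length st ≡ h + length (x ∷ xs)
parse-complete h [] x xs v with ≡ᵇ⇒≡ h 0 v
... | refl = x ∷ xs , refl , refl
parse-complete h (up13 ∷ s) x xs v
  with parse-complete (3 + h) s x xs (subst (λ k → T (aboveEndsZeroᵇ k s)) (+-comm h 3) v)
... | a ∷ b ∷ c ∷ d ∷ r , e , len rewrite e =
  node₄ a b c d ∷ r , refl , suc-injective (suc-injective (suc-injective len))
... | _ ∷ _ ∷ _ ∷ [] , _ , len =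
  ⊥-elim (m+1+n≢0 h (sym (suc-injective (suc-injective (suc-injective len)))))
parse-complete h (up22 ∷ s) x xs v
  with parse-complete (2 + h) s x xs (subst (λ k → T (aboveEndsZeroᵇ k s)) (+-comm h 2) v)
... | a ∷ b ∷ c ∷ r , e , len rewrite e =
  node₃ a b c ∷ r , refl , suc-injective (suc-injective len)
... | _ ∷ _ ∷ [] , _ , len = ⊥-elim (m+1+n≢0 h (sym (suc-injective (suc-injective len))))
parse-complete zero    (down11 ∷ s) x xs ()
parse-complete (suc h) (down11 ∷ s) x xs v with parse-complete h s x xs v
... | st , e , len rewrite e = leaf ∷ st , refl , cong suc len

decodePath : List Step → Tree
decodePath s with parse s (just (leaf ∷ []))
... | just (t ∷ []) = t
... | _             = leaf

decodePath-path : ∀ t → decodePath (path t) ≡ t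
decodePath-path t rewrite parse-path t = refl

path-decodePath : ∀ s → T (aboveEndsZeroᵇ 0 s) → path (decodePath s) ≡ s
path-decodePath s v with parse s (just (leaf ∷ [])) in e | parse-complete 0 s leaf [] v
... | just (t ∷ []) | _ , refl , _ = ++-cancelʳ (down11 ∷ []) (path t) s (begin
  path t ++ down11 ∷ [] ≡⟨ code≡path∷down t ⟨
  code t                ≡⟨ ++-identityʳ (code t) ⟨
  codes (t ∷ [])        ≡⟨ parse-sound s (leaf ∷ []) (t ∷ []) e ⟩
  s ++ down11 ∷ []      ∎)
  where open ≡-Reasoning

paths↔trees : ∀ n → Paths n ↔ TreeOfSize n
paths↔trees n = mk↔ₛ′ to from to∘from from∘to
  where
  split : ∀ s → T (isPathᵇ n s) → T (xlen s ≡ᵇ 4 * n) × T (aboveEndsZeroᵇ 0 s)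
  split s = Equivalence.to T-∧
  to : Paths n → TreeOfSize n
  to (s , p) = decodePath s , *-cancelˡ-≡ (size (decodePath s)) n 4 (begin
    4 * size (decodePath s)  ≡⟨ xlen-path (decodePath s) ⟨
    xlen (path (decodePath s)) ≡⟨ cong xlen (path-decodePath s (proj₂ (split s p))) ⟩
    xlen s                   ≡⟨ ≡ᵇ⇒≡ _ _ (proj₁ (split s p)) ⟩
    4 * n                    ∎)
    where open ≡-Reasoning
  from : TreeOfSize n → Paths n
  from (t , e) = path t , Equivalence.from T-∧
    (≡⇒≡ᵇ (xlen (path t)) (4 * n) (trans (xlen-path t) (cong (4 *_) e)) , path-valid t)
  to∘from : ∀ x → to (from x) ≡ x
  to∘from (t , e) = Σ-size-≡ _ _ (decodePath-path t)
  from∘to : ∀ x → from (to x) ≡ x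
  from∘to (s , p) = Σ-T-≡ {P = isPathᵇ n} _ _ (path-decodePath s (proj₂ (split s p)))

shift : ℕ → List ℕ → List ℕ
shift k = map (k +_)

-- glue X Y = X shifted above everything else, then a new minimum 0, then
-- Y shifted by one.  Every 213-avoiding permutation with a 0 has this form.
glue : List ℕ → List ℕ → List ℕ
glue X Y = shift (suc (length Y)) X ++ 0 ∷ shift 1 Y

length-glue : ∀ X Y → length (glue X Y) ≡ length X + suc (length Y)
length-glue X Y = begin
  length (shift (suc (length Y)) X ++ 0 ∷ shift 1 Y)
    ≡⟨ length-++ (shift (suc (length Y)) X) ⟩
  length (shift (suc (length Y)) X) + suc (length (shift 1 Y))
    ≡⟨ cong₂ (λ a b → a + suc b) (length-map (suc (length Y) +_) X) (length-map (1 +_) Y) ⟩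
  length X + suc (length Y) ∎
  where open ≡-Reasoning

glue-longer-left : ∀ X Y → length X < length (glue X Y)
glue-longer-left X Y rewrite length-glue X Y | +-suc (length X) (length Y) =
  s≤s (m≤m+n (length X) (length Y))

glue-longer-right : ∀ X Y → length Y < length (glue X Y)
glue-longer-right X Y rewrite length-glue X Y = m≤n+m (suc (length Y)) (length X)

splitAtZero : List ℕ → Maybe (List ℕ × List ℕ)
splitAtZero []           = nothing
splitAtZero (zero ∷ xs)  = just ([] , xs)
splitAtZero (suc x ∷ xs) with splitAtZero xs
... | nothing      = nothing
... | just (A , B) = just (suc x ∷ A , B)

unglue : List ℕ → Maybe (List ℕ × List ℕ)
unglue w with splitAtZero w
... | nothing      = nothing
... | just (A , B) = just (map (_∸ suc (length B)) A , map (_∸ 1) B)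

splitAtZero-glue : ∀ k X Z → splitAtZero (shift (suc k) X ++ 0 ∷ Z) ≡ just (shift (suc k) X , Z)
splitAtZero-glue k []      Z = refl
splitAtZero-glue k (x ∷ X) Z rewrite splitAtZero-glue k X Z = refl

unshift-shift : ∀ k X → map (_∸ k) (shift k X) ≡ X
unshift-shift k []      = refl
unshift-shift k (x ∷ X) = cong₂ _∷_ (m+n∸m≡n k x) (unshift-shift k X)

unglue-glue : ∀ X Y → unglue (glue X Y) ≡ just (X , Y)
unglue-glue X Y rewrite splitAtZero-glue (length Y) X (shift 1 Y) | length-map (1 +_) Y
  | unshift-shift (suc (length Y)) X | unshift-shift 1 Y = refl

-- How many leading entries of a word are still owed to an unfinished
-- block: a word of offset o satisfies the block condition after skipping
-- `free o` entries.
data Offset : Set where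
  o₀ o₁ o₂ : Offset

free : Offset → ℕ
free o₀ = 0
free o₁ = 1
free o₂ = 2

-- build β t grows the tree t on top of the base word β: an internal node
-- glues the word grown from its first child (same base) to a word of
-- offset 2 grown from its last child, whose base is given by the middle
-- children (see base below).
build : List ℕ → Tree → List ℕ
build β leaf                = β
build β (node₄ a p₁ p₂ q)   = glue (build β a) (build (glue [] (build (glue [] (build [] p₁)) p₂)) q)
build β (node₃ a p q)       = glue (build β a) (build (glue (0 ∷ []) (build [] p)) q)

Base : Offset → Set
Base o₀ = ⊤
Base o₁ = Tree
Base o₂ = (Tree × Tree) ⊎ Tree

base : ∀ o → Base o → List ℕ
base o₀ _                  = []
base o₁ g                  = glue [] (build [] g)
base o₂ (inj₁ (p₁ , p₂))   = glue [] (build (base o₁ p₁) p₂)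
base o₂ (inj₂ p)           = glue (0 ∷ []) (build [] p)

graft : Tree → Base o₂ × Tree → Tree
graft a (inj₁ (p₁ , p₂) , q) = node₄ a p₁ p₂ q
graft a (inj₂ p , q)         = node₃ a p q

build-graft : ∀ β a bq →
  build β (graft a bq) ≡ glue (build β a) (build (base o₂ (proj₁ bq)) (proj₂ bq))
build-graft β a (inj₁ _ , q) = refl
build-graft β a (inj₂ _ , q) = refl

-- Building only lengthens the base, and a base of offset o has at least
-- free o entries; hence a first child is never mistaken for a base.
build-longer : ∀ β t → length β ≤ length (build β t)
build-longer β leaf              = ≤-refl
build-longer β (node₄ a _ _ _)   = ≤-trans (build-longer β a) (<⇒≤ (glue-longer-left (build β a) _))
build-longer β (node₃ a _ _)     = ≤-trans (build-longer β a) (<⇒≤ (glue-longer-left (build β a) _))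

base-length : ∀ o β → free o ≤ length (base o β)
base-length o₀ _                  = z≤n
base-length o₁ g                  = s≤s z≤n
base-length o₂ (inj₁ (p₁ , p₂))   = subst (2 ≤_) (sym (length-glue [] (build (base o₁ p₁) p₂)))
                                      (s≤s (≤-trans (s≤s z≤n) (build-longer (base o₁ p₁) p₂)))
base-length o₂ (inj₂ p)           = s≤s (s≤s z≤n)

-- Each internal node contributes three entries: the 0 at which it is glued
-- and, in the base of its last child, either one more 0 (node₄, whose base
-- holds two subtrees) or two more entries (node₃).
length-build : ∀ β t → length (build β t) ≡ length β + 3 * size t

length-node : ∀ β a b q → length (build β (graft a (b , q))) ≡
              length β + 3 * size a + suc (length (base o₂ b) + 3 * size q)
length-node β a b q = begin
  length (build β (graft a (b , q)))
    ≡⟨ cong length (build-graft β a (b , q)) ⟩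
  length (glue (build β a) (build (base o₂ b) q))
    ≡⟨ length-glue (build β a) (build (base o₂ b) q) ⟩
  length (build β a) + suc (length (build (base o₂ b) q))
    ≡⟨ cong₂ (λ x y → x + suc y) (length-build β a) (length-build (base o₂ b) q) ⟩
  length β + 3 * size a + suc (length (base o₂ b) + 3 * size q) ∎
  where open ≡-Reasoning

length-base₄ : ∀ p₁ p₂ → length (base o₂ (inj₁ (p₁ , p₂))) ≡ 2 + 3 * size p₁ + 3 * size p₂
length-base₄ p₁ p₂ = begin
  length (glue [] (build (base o₁ p₁) p₂))            ≡⟨ length-glue [] (build (base o₁ p₁) p₂) ⟩
  suc (length (build (base o₁ p₁) p₂))                ≡⟨ cong suc (length-build (base o₁ p₁) p₂) ⟩
  suc (length (glue [] (build [] p₁)) + 3 * size p₂)  ≡⟨ cong (λ z → suc (z + 3 * size p₂))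
                                                           (trans (length-glue [] (build [] p₁))
                                                                  (cong suc (length-build [] p₁))) ⟩
  2 + 3 * size p₁ + 3 * size p₂                       ∎
  where open ≡-Reasoning

length-base₃ : ∀ p → length (base o₂ (inj₂ p)) ≡ 2 + 3 * size p
length-base₃ p = trans (length-glue (0 ∷ []) (build [] p)) (cong (2 +_) (length-build [] p))

length-build β leaf = sym (+-identityʳ (length β))
length-build β (node₄ a p₁ p₂ q) = begin
  length (build β (node₄ a p₁ p₂ q))
    ≡⟨ length-node β a (inj₁ (p₁ , p₂)) q ⟩
  length β + 3 * size a + suc (length (base o₂ (inj₁ (p₁ , p₂))) + 3 * size q)
    ≡⟨ cong (λ z → length β + 3 * size a + suc (z + 3 * size q)) (length-base₄ p₁ p₂) ⟩
  length β + 3 * size a + suc (2 + 3 * size p₁ + 3 * size p₂ + 3 * size q)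
    ≡⟨ arith (length β) (size a) (size p₁) (size p₂) (size q) ⟩
  length β + 3 * size (node₄ a p₁ p₂ q) ∎
  where
  open ≡-Reasoning
  arith : ∀ b a p₁ p₂ q → b + 3 * a + suc (2 + 3 * p₁ + 3 * p₂ + 3 * q)
                        ≡ b + 3 * suc (a + p₁ + p₂ + q)
  arith = solve-∀
length-build β (node₃ a p q) = begin
  length (build β (node₃ a p q))
    ≡⟨ length-node β a (inj₂ p) q ⟩
  length β + 3 * size a + suc (length (base o₂ (inj₂ p)) + 3 * size q)
    ≡⟨ cong (λ z → length β + 3 * size a + suc (z + 3 * size q)) (length-base₃ p) ⟩
  length β + 3 * size a + suc (2 + 3 * size p + 3 * size q)
    ≡⟨ arith (length β) (size a) (size p) (size q) ⟩
  length β + 3 * size (node₃ a p q) ∎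
  where
  open ≡-Reasoning
  arith : ∀ b a p q → b + 3 * a + suc (2 + 3 * p + 3 * q) ≡ b + 3 * suc (a + p + q)
  arith = solve-∀

-- The decoders run on fuel, which only has to exceed the length of the
-- word; each step unglues the word at its 0.  A left part shorter than the
-- offset is (part of) the base, otherwise it is the first child of a node.
defaultBase : ∀ o → Base o
defaultBase o₀ = tt
defaultBase o₁ = leaf
defaultBase o₂ = inj₂ leaf

decode : ∀ o → ℕ → List ℕ → Base o × Tree
decodeGlued : ∀ o → ℕ → List ℕ → List ℕ → Base o × Tree

extend : ∀ o → ℕ → List ℕ → List ℕ → Base o × Tree
extend o f X Y = proj₁ (decode o f X) , graft (proj₂ (decode o f X)) (decode o₂ f Y)

decode o zero    w = defaultBase o , leaf
decode o (suc f) w with unglue w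
... | nothing      = defaultBase o , leaf
... | just (X , Y) = decodeGlued o f X Y

decodeGlued o₀ f X           Y = extend o₀ f X Y
decodeGlued o₁ f []          Y = proj₂ (decode o₀ f Y) , leaf
decodeGlued o₁ f X@(_ ∷ _)   Y = extend o₁ f X Y
decodeGlued o₂ f []          Y = inj₁ (decode o₁ f Y) , leaf
decodeGlued o₂ f (_ ∷ [])    Y = inj₂ (proj₂ (decode o₀ f Y)) , leaf
decodeGlued o₂ f X@(_ ∷ _ ∷ _) Y = extend o₂ f X Y

decodeGlued-long : ∀ o f X Y → free o ≤ length X → decodeGlued o f X Y ≡ extend o f X Y
decodeGlued-long o₀ f X               Y _           = refl
decodeGlued-long o₁ f (_ ∷ _)         Y _           = refl
decodeGlued-long o₂ f (_ ∷ _ ∷ _)     Y _           = refl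
decodeGlued-long o₂ f (_ ∷ [])        Y (s≤s ())

decode-glue : ∀ o f X Y → decode o (suc f) (glue X Y) ≡ decodeGlued o f X Y
decode-glue o f X Y rewrite unglue-glue X Y = refl

left-fuel : ∀ f X Y → length (glue X Y) < suc f → length X < f
left-fuel f X Y l = ≤-trans (glue-longer-left X Y) (≤-pred l)

right-fuel : ∀ f X Y → length (glue X Y) < suc f → length Y < f
right-fuel f X Y l = ≤-trans (glue-longer-right X Y) (≤-pred l)

decode-build : ∀ o β t f → length (build (base o β) t) < f →
               decode o f (build (base o β) t) ≡ (β , t)
decode-build-graft : ∀ o β a b q f →
  length (glue (build (base o β) a) (build (base o₂ b) q)) < suc f →
  decode o (suc f) (glue (build (base o β) a) (build (base o₂ b) q)) ≡ (β , graft a (b , q))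

decode-build o₀ tt leaf (suc f) _ = refl
decode-build o₁ g leaf (suc f) l
  rewrite decode-glue o₁ f [] (build [] g)
        | decode-build o₀ tt g f (right-fuel f [] (build [] g) l) = refl
decode-build o₂ (inj₁ (p₁ , p₂)) leaf (suc f) l
  rewrite decode-glue o₂ f [] (build (base o₁ p₁) p₂)
        | decode-build o₁ p₁ p₂ f (right-fuel f [] (build (base o₁ p₁) p₂) l) = refl
decode-build o₂ (inj₂ p) leaf (suc f) l
  rewrite decode-glue o₂ f (0 ∷ []) (build [] p)
        | decode-build o₀ tt p f (right-fuel f (0 ∷ []) (build [] p) l) = refl
decode-build o β (node₄ a p₁ p₂ q) (suc f) l = decode-build-graft o β a (inj₁ (p₁ , p₂)) q f l
decode-build o β (node₃ a p q)     (suc f) l = decode-build-graft o β a (inj₂ p) q f l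

decode-build-graft o β a b q f l = begin
  decode o (suc f) (glue X Y)   ≡⟨ decode-glue o f X Y ⟩
  decodeGlued o f X Y           ≡⟨ decodeGlued-long o f X Y
                                     (≤-trans (base-length o β) (build-longer (base o β) a)) ⟩
  extend o f X Y                ≡⟨ cong₂ (λ u v → proj₁ u , graft (proj₂ u) v)
                                         (decode-build o β a f (left-fuel f X Y l))
                                         (decode-build o₂ b q f (right-fuel f X Y l)) ⟩
  (β , graft a (b , q))         ∎
  where
  open ≡-Reasoning
  X = build (base o β) a
  Y = build (base o₂ b) q

-- Boolean connectives under T; the operands are explicit in the
-- eliminators because T is not injective.
∧-elim : ∀ x y → T (x ∧ y) → T x × T y
∧-elim x y = Equivalence.to (T-∧ {x} {y})

∧-intro : ∀ {x y} → T x → T y → T (x ∧ y)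
∧-intro p q = Equivalence.from T-∧ (p , q)

∨-elim : ∀ x y → T (x ∨ y) → T x ⊎ T y
∨-elim x y = Equivalence.to (T-∨ {x} {y})

∨-introˡ : ∀ {x y} → T x → T (x ∨ y)
∨-introˡ p = Equivalence.from T-∨ (inj₁ p)

∨-introʳ : ∀ x {y} → T y → T (x ∨ y)
∨-introʳ x q = Equivalence.from (T-∨ {x}) (inj₂ q)

<ᵇ-shift : ∀ k a b → ((k + a) <ᵇ (k + b)) ≡ (a <ᵇ b)
<ᵇ-shift zero    a b = refl
<ᵇ-shift (suc k) a b = <ᵇ-shift k a b

blocksAfter : ℕ → List ℕ → Bool
blocksAfter zero    = blocksOKᵇ
blocksAfter (suc r) []       = false
blocksAfter (suc r) (x ∷ xs) = blocksAfter r xs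

blocks-shift : ∀ r k xs → blocksAfter r (shift k xs) ≡ blocksAfter r xs
blocks-shift zero k []               = refl
blocks-shift zero k (a ∷ [])         = refl
blocks-shift zero k (a ∷ b ∷ [])     = refl
blocks-shift zero k (a ∷ b ∷ c ∷ xs)
  rewrite <ᵇ-shift k a b | <ᵇ-shift k a c | blocks-shift zero k xs = refl
blocks-shift (suc r) k []       = refl
blocks-shift (suc r) k (x ∷ xs) = blocks-shift r k xs

-- An entry 0 cannot follow the first entry of a block, so once the skipped
-- entries lie before it, it starts a block.
blocks-split : ∀ r A B → r ≤ length A → T (blocksAfter r (A ++ 0 ∷ B)) →
               T (blocksAfter r A) × T (blocksAfter 2 B)
blocks-split (suc r) (a ∷ A) B (s≤s r≤) p = blocks-split r A B r≤ p
blocks-split zero [] (b ∷ c ∷ B) _ p =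
  _ , proj₂ (∧-elim (0 <ᵇ c) _ (proj₂ (∧-elim (0 <ᵇ b) _ p)))
blocks-split zero (a ∷ []) (c ∷ B) _ ()
blocks-split zero (a ∷ b ∷ []) B _ p =
  ⊥-elim (proj₁ (∧-elim (a <ᵇ 0) (blocksOKᵇ B) (proj₂ (∧-elim (a <ᵇ b) _ p))))
blocks-split zero (a ∷ b ∷ c ∷ A) B _ p
  with ∧-elim (a <ᵇ b) _ p
... | a<b , p′ with ∧-elim (a <ᵇ c) _ p′
... | a<c , p″ with blocks-split zero A B z≤n p″
... | pA , pB = ∧-intro a<b (∧-intro a<c pA) , pB

blocks-join : ∀ r A Y → T (blocksAfter r A) → T (blocksAfter 2 Y) →
              T (blocksAfter r (A ++ 0 ∷ shift 1 Y))
blocks-join (suc r) (a ∷ A) Y p q = blocks-join r A Y p q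
blocks-join zero [] (y₁ ∷ y₂ ∷ Y) p q = subst T (sym (blocks-shift zero 1 Y)) q
blocks-join zero (a ∷ b ∷ c ∷ A) Y p q
  with ∧-elim (a <ᵇ b) _ p
... | a<b , p′ with ∧-elim (a <ᵇ c) _ p′
... | a<c , p″ = ∧-intro a<b (∧-intro a<c (blocks-join zero A Y p″ q))

Avoids213 : List ℕ → Set
Avoids213 w = ¬ T (contains213 w)

any-++ˡ : ∀ (p : ℕ → Bool) xs ys → T (any p xs) → T (any p (xs ++ ys))
any-++ˡ p xs ys h = AnyP.any⁺ p (AnyP.++⁺ˡ (AnyP.any⁻ p xs h))

any-++⁻ : ∀ (p : ℕ → Bool) xs ys → T (any p (xs ++ ys)) → T (any p xs) ⊎ T (any p ys)
any-++⁻ p xs ys h with AnyP.++⁻ xs (AnyP.any⁻ p (xs ++ ys) h)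
... | inj₁ hx = inj₁ (AnyP.any⁺ p hx)
... | inj₂ hy = inj₂ (AnyP.any⁺ p hy)

any-above-none : ∀ x ys → All (_< x) ys → ¬ T (any (x <ᵇ_) ys)
any-above-none x ys ys<x h =
  AllP.All¬⇒¬Any (All.map (λ {z} z<x x<z → <-asym z<x (<ᵇ⇒< x z x<z)) ys<x) (AnyP.any⁻ (x <ᵇ_) ys h)

occ-++ʳ : ∀ x xs ys → T (occ213From x ys) → T (occ213From x (xs ++ ys))
occ-++ʳ x []       ys h = h
occ-++ʳ x (y ∷ xs) ys h = ∨-introʳ ((y <ᵇ x) ∧ any (x <ᵇ_) (xs ++ ys)) (occ-++ʳ x xs ys h)

occ-++ˡ : ∀ x xs ys → T (occ213From x xs) → T (occ213From x (xs ++ ys))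
occ-++ˡ x (y ∷ xs) ys h with ∨-elim ((y <ᵇ x) ∧ any (x <ᵇ_) xs) _ h
... | inj₁ q = ∨-introˡ (∧-intro (proj₁ q′) (any-++ˡ (x <ᵇ_) xs ys (proj₂ q′)))
  where q′ = ∧-elim (y <ᵇ x) _ q
... | inj₂ q = ∨-introʳ ((y <ᵇ x) ∧ any (x <ᵇ_) (xs ++ ys)) (occ-++ˡ x xs ys q)

contains-++ʳ : ∀ xs ys → T (contains213 ys) → T (contains213 (xs ++ ys))
contains-++ʳ []       ys h = h
contains-++ʳ (x ∷ xs) ys h = ∨-introʳ (occ213From x (xs ++ ys)) (contains-++ʳ xs ys h)

contains-++ˡ : ∀ xs ys → T (contains213 xs) → T (contains213 (xs ++ ys))
contains-++ˡ (x ∷ xs) ys h with ∨-elim (occ213From x xs) _ h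
... | inj₁ q = ∨-introˡ (occ-++ˡ x xs ys q)
... | inj₂ q = ∨-introʳ (occ213From x (xs ++ ys)) (contains-++ˡ xs ys q)

contains-witness : ∀ A₁ a A₂ b B → 0 < a → a < b → b ∈ B →
                   T (contains213 (A₁ ++ a ∷ A₂ ++ 0 ∷ B))
contains-witness A₁ a A₂ b B 0<a a<b b∈B = contains-++ʳ A₁ (a ∷ A₂ ++ 0 ∷ B)
  (∨-introˡ (occ-++ʳ a A₂ (0 ∷ B)
    (∨-introˡ (∧-intro (<⇒<ᵇ 0<a) (AnyP.any⁺ (a <ᵇ_) (Any.map (λ { refl → <⇒<ᵇ a<b }) b∈B))))))

any-above-shift : ∀ k x ys → any ((k + x) <ᵇ_) (shift k ys) ≡ any (x <ᵇ_) ys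
any-above-shift k x []       = refl
any-above-shift k x (y ∷ ys) rewrite <ᵇ-shift k x y | any-above-shift k x ys = refl

occ-shift : ∀ k x ys → occ213From (k + x) (shift k ys) ≡ occ213From x ys
occ-shift k x []       = refl
occ-shift k x (y ∷ ys) rewrite <ᵇ-shift k y x | any-above-shift k x ys | occ-shift k x ys = refl

contains-shift : ∀ k xs → contains213 (shift k xs) ≡ contains213 xs
contains-shift k []       = refl
contains-shift k (x ∷ xs) rewrite occ-shift k x xs | contains-shift k xs = refl

occ-below : ∀ x xs ys → ¬ T (occ213From x xs) → All (_< x) ys → ¬ T (occ213From x (xs ++ ys))
occ-below x [] [] _ _ ()
occ-below x [] (y ∷ ys) n (_ ∷ ys<x) h with ∨-elim ((y <ᵇ x) ∧ any (x <ᵇ_) ys) _ h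
... | inj₁ q = any-above-none x ys ys<x (proj₂ (∧-elim (y <ᵇ x) _ q))
... | inj₂ q = occ-below x [] ys n ys<x q
occ-below x (y ∷ xs) ys n ys<x h with ∨-elim ((y <ᵇ x) ∧ any (x <ᵇ_) (xs ++ ys)) _ h
... | inj₂ q = occ-below x xs ys (λ r → n (∨-introʳ ((y <ᵇ x) ∧ any (x <ᵇ_) xs) r)) ys<x q
... | inj₁ q with ∧-elim (y <ᵇ x) _ q
... | y<x , above with any-++⁻ (x <ᵇ_) xs ys above
... | inj₁ r = n (∨-introˡ (∧-intro y<x r))
... | inj₂ r = any-above-none x ys ys<x r

avoids-++ : ∀ xs ys → Avoids213 xs → Avoids213 ys →
            All (λ x → All (_< x) ys) xs → Avoids213 (xs ++ ys)
avoids-++ []       ys _  ny _ h = ny h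
avoids-++ (x ∷ xs) ys nx ny (x>ys ∷ xs>ys) h with ∨-elim (occ213From x (xs ++ ys)) _ h
... | inj₁ q = occ-below x xs ys (λ r → nx (∨-introˡ r)) x>ys q
... | inj₂ q = avoids-++ xs ys (λ r → nx (∨-introʳ (occ213From x xs) r)) ny xs>ys q

avoids-0∷ : ∀ Z → Avoids213 Z → Avoids213 (0 ∷ Z)
avoids-0∷ Z n h with ∨-elim (occ213From 0 Z) _ h
... | inj₁ q = zero-no-occ Z q
  where
  zero-no-occ : ∀ Z → ¬ T (occ213From 0 Z)
  zero-no-occ (z ∷ Z) h = zero-no-occ Z h
... | inj₂ q = n q

IsPerm : List ℕ → Set
IsPerm w = All (_< length w) w × Unique w

InRange : ℕ → ℕ → ℕ → Set
InRange lo hi x = lo ≤ x × x < hi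

unique-++⁻ : ∀ (xs : List ℕ) {ys} → Unique (xs ++ ys) →
             Unique xs × Unique ys × All (λ x → All (x ≢_) ys) xs
unique-++⁻ []       u          = [] , u , []
unique-++⁻ (x ∷ xs) (x∉ ∷ u) with unique-++⁻ xs u
... | uxs , uys , apart = (AllP.++⁻ˡ xs x∉ ∷ uxs) , uys , (AllP.++⁻ʳ xs x∉ ∷ apart)

unique-++-above : ∀ {xs ys : List ℕ} → Unique xs → Unique ys → All (λ x → All (_< x) ys) xs →
                  Unique (xs ++ ys)
unique-++-above uxs uys above =
  UniqueP.++⁺ uxs uys (λ (v∈xs , v∈ys) → <-irrefl refl (All.lookup (All.lookup above v∈xs) v∈ys))

unique-remove : ∀ (ys : List ℕ) h zs → Unique (ys ++ h ∷ zs) → Unique (ys ++ zs) × All (h ≢_) (ys ++ zs)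
unique-remove []       h zs (h∉ ∷ u) = u , h∉
unique-remove (y ∷ ys) h zs (y∉ ∷ u) with unique-remove ys h zs u | AllP.++⁻ʳ ys y∉
... | u′ , h∉ | y≢h ∷ y∉zs = (AllP.++⁺ (AllP.++⁻ˡ ys y∉) y∉zs ∷ u′) , (≢-sym y≢h ∷ h∉)

narrow : ∀ {lo h} (xs : List ℕ) → All (h ≢_) xs → All (InRange lo (suc h)) xs → All (InRange lo h) xs
narrow []       []           []                   = []
narrow (x ∷ xs) (h≢x ∷ h∉xs) ((lo≤x , x≤h) ∷ rs) =
  (lo≤x , ≤∧≢⇒< (≤-pred x≤h) (≢-sym h≢x)) ∷ narrow xs h∉xs rs

length-insert : ∀ (ys : List ℕ) h zs → length (ys ++ h ∷ zs) ≡ suc (length (ys ++ zs))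
length-insert ys h zs = begin
  length (ys ++ h ∷ zs)            ≡⟨ length-++ ys ⟩
  length ys + suc (length zs)      ≡⟨ +-suc (length ys) (length zs) ⟩
  suc (length ys + length zs)      ≡⟨ cong suc (length-++ ys) ⟨
  suc (length (ys ++ zs))          ∎
  where open ≡-Reasoning

-- Pigeonhole principle: distinct numbers from [lo, hi) number at most hi − lo.
-- By induction on hi: remove hi − 1 if it occurs.
pigeonhole : ∀ hi lo xs → lo ≤ hi → Unique xs → All (InRange lo hi) xs → lo + length xs ≤ hi
pigeonhole zero    lo []      lo≤ _ _                = subst (_≤ 0) (sym (+-identityʳ lo)) lo≤
pigeonhole zero    lo (_ ∷ _) _   _ ((_ , ()) ∷ _)
pigeonhole (suc h) lo xs      lo≤ u r with h ∈? xs
... | yes h∈ = pigeonhole-with h lo xs u r (∈-∃++ h∈)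
  where
  pigeonhole-with : ∀ h lo (xs : List ℕ) → Unique xs → All (InRange lo (suc h)) xs →
                    Σ[ ys ∈ List ℕ ] Σ[ zs ∈ List ℕ ] xs ≡ ys ++ h ∷ zs → lo + length xs ≤ suc h
  pigeonhole-with h lo .(ys ++ h ∷ zs) u r (ys , zs , refl) = begin
    lo + length (ys ++ h ∷ zs)      ≡⟨ cong (lo +_) (length-insert ys h zs) ⟩
    lo + suc (length (ys ++ zs))    ≡⟨ +-suc lo _ ⟩
    suc (lo + length (ys ++ zs))    ≤⟨ s≤s (pigeonhole h lo (ys ++ zs) lo≤h (proj₁ removed)
                                          (narrow (ys ++ zs) (proj₂ removed) rest)) ⟩
    suc h                           ∎
    where
    open ≤-Reasoning
    removed = unique-remove ys h zs u
    lo≤h : lo ≤ h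
    lo≤h = proj₁ (All.head (AllP.++⁻ʳ ys r))
    rest : All (InRange lo (suc h)) (ys ++ zs)
    rest = AllP.++⁺ (AllP.++⁻ˡ ys r) (All.tail (AllP.++⁻ʳ ys r))
... | no h∉ with lo ≤? h
...   | yes lo≤h = m≤n⇒m≤1+n (pigeonhole h lo xs lo≤h u (narrow xs (AllP.¬Any⇒All¬ xs h∉) r))
...   | no lo≰h = empty xs r
  where
  empty : ∀ (xs : List ℕ) → All (InRange lo (suc h)) xs → lo + length xs ≤ suc h
  empty []      []                 = subst (_≤ suc h) (sym (+-identityʳ lo)) lo≤
  empty (_ ∷ _) ((lo≤x , x≤h) ∷ _) = ⊥-elim (lo≰h (≤-trans lo≤x (≤-pred x≤h)))

zero∈perm : ∀ w → IsPerm w → 0 < length w → 0 ∈ w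
zero∈perm w (w< , u) 0<len with 0 ∈? w
... | yes 0∈ = 0∈
... | no 0∉ = ⊥-elim (n≮n (length w) (pigeonhole (length w) 1 w 0<len u
        (All.zipWith (λ (0≢x , x<) → n≢0⇒n>0 (≢-sym 0≢x) , x<) (AllP.¬Any⇒All¬ w 0∉ , w<))))

standardise : ℕ → List ℕ → List ℕ
standardise k = map (_∸ k)

shift-standardise : ∀ k xs → All (k ≤_) xs → shift k (standardise k xs) ≡ xs
shift-standardise k []       []          = refl
shift-standardise k (x ∷ xs) (k≤x ∷ k≤) = cong₂ _∷_ (m+[n∸m]≡n k≤x) (shift-standardise k xs k≤)

standardise-perm : ∀ k xs → Unique xs → All (InRange k (k + length xs)) xs →
                   IsPerm (standardise k xs)
standardise-perm k xs u r =
  subst (λ n → All (_< n) (standardise k xs)) (sym (length-map (_∸ k) xs))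
        (AllP.map⁺ (All.map (λ (k≤x , x<) →
          subst (_ <_) (m+n∸m≡n k (length xs)) (∸-monoˡ-< x< k≤x)) r))
  , UniqueP.map⁻ (subst Unique (sym (shift-standardise k xs (All.map proj₁ r))) u)

standardise-avoids : ∀ k xs → All (k ≤_) xs → Avoids213 xs → Avoids213 (standardise k xs)
standardise-avoids k xs k≤ n h =
  n (subst (λ w → T (contains213 w)) (shift-standardise k xs k≤)
           (subst T (sym (contains-shift k (standardise k xs))) h))

-- In a 213-avoider every entry before the 0 exceeds every entry after it:
-- otherwise a, 0, b with a < b would be an occurrence.
left-above-right : ∀ A B → All (λ a → All (a ≢_) (0 ∷ B)) A → Avoids213 (A ++ 0 ∷ B) →
                   All (λ a → All (_< a) B) A
left-above-right A B apart n = All.tabulate λ {a} a∈A → All.tabulate λ {b} b∈B → below a∈A b∈B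
  where
  below : ∀ {a b} → a ∈ A → b ∈ B → b < a
  below {a} {b} a∈A b∈B with b <? a | ∈-∃++ a∈A
  ... | yes b<a | _ = b<a
  ... | no b≮a | A₁ , A₂ , refl = ⊥-elim (n (subst (λ w → T (contains213 w))
        (sym (++-assoc A₁ (a ∷ A₂) (0 ∷ B)))
        (contains-witness A₁ a A₂ b B (n≢0⇒n>0 (All.head a-apart))
          (≤∧≢⇒< (≮⇒≥ b≮a) (All.lookup a-apart (there b∈B))) b∈B)))
    where
    a-apart = All.lookup apart a∈A

glue-left-above : ∀ X Y → All (_< length Y) Y →
                  All (λ x → All (_< x) (0 ∷ shift 1 Y)) (shift (suc (length Y)) X)
glue-left-above X Y Y< = AllP.map⁺ (All.tabulate λ {x} _ →
  s≤s z≤n ∷ AllP.map⁺ (All.map (λ y< → +-monoʳ-≤ 1 (≤-trans y< (m≤m+n (length Y) x))) Y<))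

glue-perm : ∀ X Y → IsPerm X → IsPerm Y → IsPerm (glue X Y)
glue-perm X Y (X< , uX) (Y< , uY) =
  subst (λ n → All (_< n) (glue X Y)) (sym (length-glue X Y))
    (AllP.++⁺ (AllP.map⁺ (All.map (λ {x} x< → subst (_< length X + k) (+-comm x k) (+-monoˡ-< k x<)) X<))
              (≤-trans (s≤s z≤n) (m≤n+m k (length X))
                ∷ AllP.map⁺ (All.map (λ y< → ≤-trans (s≤s y<) (m≤n+m k (length X))) Y<)))
  , unique-++-above (UniqueP.map⁺ (+-cancelˡ-≡ k _ _) uX)
                    ((AllP.map⁺ (All.tabulate λ _ ()) ∷ UniqueP.map⁺ suc-injective uY))
                    (glue-left-above X Y Y<)
  where k = suc (length Y)

glue-avoids : ∀ X Y → All (_< length Y) Y → Avoids213 X → Avoids213 Y → Avoids213 (glue X Y)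
glue-avoids X Y Y< nX nY =
  avoids-++ (shift k X) (0 ∷ shift 1 Y)
    (λ h → nX (subst T (contains-shift k X) h))
    (avoids-0∷ (shift 1 Y) (λ h → nY (subst T (contains-shift 1 Y) h)))
    (glue-left-above X Y Y<)
  where k = suc (length Y)

record Glued (w : List ℕ) : Set where
  field
    left right   : List ℕ
    glued        : w ≡ glue left right
    left-perm    : IsPerm left
    right-perm   : IsPerm right
    left-avoids  : Avoids213 left
    right-avoids : Avoids213 right

-- Counting: if distinct positive values A lie above distinct positive
-- values B, all below |A| + |B| + 1, then B fills [1, |B|] (an entry b > |B|
-- would leave too little room above it for A) and A fills the rest (the
-- |B| entries of B lie below each entry of A).
split-ranges : ∀ A B → Unique A → Unique B → All (λ a → All (_< a) B) A →
  All (0 <_) A → All (0 <_) B → All (_< length A + suc (length B)) A → All (_< length A + suc (length B)) B →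
  All (InRange (suc (length B)) (suc (length B) + length A)) A × All (InRange 1 (1 + length B)) B
split-ranges A B uA uB above A-pos B-pos A< B< =
  All.zipWith (λ {a} ((a-pos , a>B) , a<) →
                 pigeonhole a 1 B a-pos uB (All.zip (B-pos , a>B)) , subst (a <_) (+-comm (length A) k) a<)
              (All.zip (A-pos , above) , A<)
  , All.tabulate λ {b} b∈B → All.lookup B-pos b∈B ,
      +-cancelʳ-≤ (length A) (suc b) k (subst (suc b + length A ≤_) (+-comm (length A) k)
        (pigeonhole (length A + k) (suc b) A (All.lookup B< b∈B) uA
          (All.zipWith (λ (a>B , a<) → All.lookup a>B b∈B , a<) (above , A<))))
  where k = suc (length B)

glued-at-zero : ∀ A B → IsPerm (A ++ 0 ∷ B) → Avoids213 (A ++ 0 ∷ B) → Glued (A ++ 0 ∷ B)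
glued-at-zero A B (w< , u) n = record
  { left = X ; right = Y
  ; glued = cong₂ (λ a b → a ++ 0 ∷ b)
      (trans (sym (shift-standardise k A (All.map proj₁ A-range)))
             (cong (λ l → shift (suc l) X) (sym (length-map (_∸ 1) B))))
      (sym (shift-standardise 1 B (All.map proj₁ B-range)))
  ; left-perm = standardise-perm k A uA A-range
  ; right-perm = standardise-perm 1 B uB B-range
  ; left-avoids = standardise-avoids k A (All.map proj₁ A-range) (λ h → n (contains-++ˡ A (0 ∷ B) h))
  ; right-avoids = standardise-avoids 1 B (All.map proj₁ B-range)
      (λ h → n (contains-++ʳ A (0 ∷ B) (∨-introʳ (occ213From 0 B) h)))
  }
  where
  k = suc (length B)
  X = standardise k A
  Y = standardise 1 B
  parts = unique-++⁻ A u
  uA = proj₁ parts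
  uB = U.tail (proj₁ (proj₂ parts))
  apart = proj₂ (proj₂ parts)
  w<′ : All (_< length A + k) (A ++ 0 ∷ B)
  w<′ = subst (λ m → All (_< m) (A ++ 0 ∷ B)) (length-++ A) w<
  ranges = split-ranges A B uA uB (left-above-right A B apart n)
    (All.map (λ a-apart → n≢0⇒n>0 (All.head a-apart)) apart)
    (All.map (λ 0≢b → n≢0⇒n>0 (≢-sym 0≢b)) (U.head (proj₁ (proj₂ parts))))
    (AllP.++⁻ˡ A w<′) (All.tail (AllP.++⁻ʳ A w<′))
  A-range = proj₁ ranges
  B-range = proj₂ ranges

Valid : Offset → List ℕ → Set
Valid o w = IsPerm w × Avoids213 w × T (blocksAfter (free o) w)

glued : ∀ w → 0 < length w → IsPerm w → Avoids213 w → Glued w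
glued w 0<len p n with ∈-∃++ (zero∈perm w p 0<len)
... | A , B , refl = glued-at-zero A B p n

encode : ∀ o → Base o × Tree → List ℕ
encode o (β , t) = build (base o β) t

build-decode : ∀ o f w → length w < f → Valid o w → encode o (decode o f w) ≡ w
build-decode-glued : ∀ o f X Y → length (glue X Y) < suc f →
  IsPerm X → IsPerm Y → Avoids213 X → Avoids213 Y → T (blocksAfter (free o) (glue X Y)) →
  encode o (decodeGlued o f X Y) ≡ glue X Y
build-decode-long : ∀ o f X Y → free o ≤ length X → length (glue X Y) < suc f →
  IsPerm X → IsPerm Y → Avoids213 X → Avoids213 Y → T (blocksAfter (free o) (glue X Y)) →
  encode o (decodeGlued o f X Y) ≡ glue X Y

build-decode o₀ (suc f) [] _ _ = refl
build-decode o₁ (suc f) [] _ (_ , _ , ())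
build-decode o₂ (suc f) [] _ (_ , _ , ())
build-decode o (suc f) w@(_ ∷ _) l (p , n , b) with glued w (s≤s z≤n) p n
... | record { left = X ; right = Y ; glued = w≡ ; left-perm = pX ; right-perm = pY
             ; left-avoids = nX ; right-avoids = nY } =
  subst (λ w → encode o (decode o (suc f) w) ≡ w) (sym w≡) (trans
    (cong (encode o) (decode-glue o f X Y))
    (build-decode-glued o f X Y (subst (λ w → length w < suc f) w≡ l) pX pY nX nY
                        (subst (λ w → T (blocksAfter (free o) w)) w≡ b)))

build-decode-glued o₀ f X Y = build-decode-long o₀ f X Y z≤n
build-decode-glued o₁ f [] Y l _ pY _ nY b =
  cong (glue []) (build-decode o₀ f Y (right-fuel f [] Y l) (pY , nY , subst T (blocks-shift 0 1 Y) b))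
build-decode-glued o₁ f X@(_ ∷ _) Y = build-decode-long o₁ f X Y (s≤s z≤n)
build-decode-glued o₂ f [] Y l _ pY _ nY b =
  cong (glue []) (build-decode o₁ f Y (right-fuel f [] Y l) (pY , nY , subst T (blocks-shift 1 1 Y) b))
build-decode-glued o₂ f (_ ∷ []) Y l ((s≤s z≤n ∷ []) , _) pY _ nY b =
  cong (glue (0 ∷ [])) (build-decode o₀ f Y (right-fuel f (0 ∷ []) Y l)
                                      (pY , nY , subst T (blocks-shift 0 1 Y) b))
build-decode-glued o₂ f X@(_ ∷ _ ∷ _) Y = build-decode-long o₂ f X Y (s≤s (s≤s z≤n))

build-decode-long o f X Y o≤X l pX pY nX nY b
  with blocks-split (free o) (shift (suc (length Y)) X) (shift 1 Y)
                    (subst (free o ≤_) (sym (length-map (suc (length Y) +_) X)) o≤X) b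
... | bX , bY = begin
  encode o (decodeGlued o f X Y)
    ≡⟨ cong (encode o) (decodeGlued-long o f X Y o≤X) ⟩
  encode o (extend o f X Y)
    ≡⟨ build-graft (base o (proj₁ dX)) (proj₂ dX) (decode o₂ f Y) ⟩
  glue (encode o dX) (encode o₂ (decode o₂ f Y))
    ≡⟨ cong₂ glue
         (build-decode o f X (left-fuel f X Y l)
                       (pX , nX , subst T (blocks-shift (free o) (suc (length Y)) X) bX))
         (build-decode o₂ f Y (right-fuel f X Y l) (pY , nY , subst T (blocks-shift 2 1 Y) bY)) ⟩
  glue X Y ∎
  where
  open ≡-Reasoning
  dX = decode o f X

glue-valid : ∀ o X Y → Valid o X → Valid o₂ Y → Valid o (glue X Y)
glue-valid o X Y (pX , nX , bX) (pY , nY , bY) =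
  glue-perm X Y pX pY , glue-avoids X Y (proj₁ pY) nX nY ,
  blocks-join (free o) (shift (suc (length Y)) X) Y (subst T (sym (blocks-shift (free o) (suc (length Y)) X)) bX) bY

glue-short-valid : ∀ o o′ X Y → IsPerm X → Avoids213 X →
  blocksAfter (free o) (glue X Y) ≡ blocksAfter (free o′) (shift 1 Y) → Valid o′ Y → Valid o (glue X Y)
glue-short-valid o o′ X Y pX nX skip (pY , nY , bY) =
  glue-perm X Y pX pY , glue-avoids X Y (proj₁ pY) nX nY ,
  subst T (sym (trans skip (blocks-shift (free o′) 1 Y))) bY

empty-valid : Valid o₀ []
empty-valid = ([] , []) , (λ ()) , _

-- Building only ever produces valid words.  (The bases are treated one
-- constructor at a time so that the recursion is visibly structural.)
build-valid : ∀ o β t → Valid o β → Valid o (build β t)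

base₁-valid : ∀ g → Valid o₁ (base o₁ g)
base₁-valid g = glue-short-valid o₁ o₀ [] (build [] g) ([] , []) (λ ()) refl
  (build-valid o₀ [] g empty-valid)

base₂-valid₄ : ∀ p₁ p₂ → Valid o₂ (base o₂ (inj₁ (p₁ , p₂)))
base₂-valid₄ p₁ p₂ = glue-short-valid o₂ o₁ [] (build (base o₁ p₁) p₂) ([] , []) (λ ()) refl
  (build-valid o₁ (base o₁ p₁) p₂ (base₁-valid p₁))

base₂-valid₃ : ∀ p → Valid o₂ (base o₂ (inj₂ p))
base₂-valid₃ p =
  glue-short-valid o₂ o₀ (0 ∷ []) (build [] p) ((s≤s z≤n ∷ []) , ([] ∷ [])) (λ ()) refl
  (build-valid o₀ [] p empty-valid)

build-valid o β leaf v = v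
build-valid o β (node₄ a p₁ p₂ q) v =
  glue-valid o _ _ (build-valid o β a v) (build-valid o₂ _ q (base₂-valid₄ p₁ p₂))
build-valid o β (node₃ a p q) v =
  glue-valid o _ _ (build-valid o β a v) (build-valid o₂ _ q (base₂-valid₃ p))

T-not⁻ : ∀ b → T (not b) → ¬ T b
T-not⁻ false _ ()

T-not⁺ : ∀ b → ¬ T b → T (not b)
T-not⁺ true  ¬b = ¬b _
T-not⁺ false _  = _

not-elem⁻ : ∀ x xs → T (not (elemᵇ x xs)) → All (x ≢_) xs
not-elem⁻ x []       _ = []
not-elem⁻ x (y ∷ ys) p with x ≡ᵇ y in eq
... | false = (λ x≡y → subst T eq (≡⇒≡ᵇ x y x≡y)) ∷ not-elem⁻ x ys p

not-elem⁺ : ∀ x xs → All (x ≢_) xs → T (not (elemᵇ x xs))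
not-elem⁺ x []       []           = _
not-elem⁺ x (y ∷ ys) (x≢y ∷ x∉ys) with x ≡ᵇ y in eq
... | true  = ⊥-elim (x≢y (≡ᵇ⇒≡ x y (subst T (sym eq) _)))
... | false = not-elem⁺ x ys x∉ys

distinct⁻ : ∀ xs → T (distinctᵇ xs) → Unique xs
distinct⁻ []       _ = []
distinct⁻ (x ∷ xs) p with ∧-elim (not (elemᵇ x xs)) _ p
... | x∉xs , rest = not-elem⁻ x xs x∉xs ∷ distinct⁻ xs rest

distinct⁺ : ∀ xs → Unique xs → T (distinctᵇ xs)
distinct⁺ []       []            = _
distinct⁺ (x ∷ xs) (x∉xs ∷ uxs) = ∧-intro (not-elem⁺ x xs x∉xs) (distinct⁺ xs uxs)

inS2-213⁻ : ∀ n w → T (inS2-213 n w) → length w ≡ 3 * n × Valid o₀ w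
inS2-213⁻ n w p with ∧-elim (isPermᵇ (3 * n) w) _ p
... | isPerm , rest with ∧-elim (length w ≡ᵇ 3 * n) _ isPerm | ∧-elim (not (contains213 w)) _ rest
... | len , bounded∧distinct | avoids , blocks with ∧-elim (all (_<ᵇ 3 * n) w) _ bounded∧distinct
... | bounded , distinct =
  length≡ , (subst (λ m → All (_< m) w) (sym length≡) (All.map (<ᵇ⇒< _ (3 * n)) (AllP.all⁺ _ w bounded))
            , distinct⁻ w distinct)
          , T-not⁻ (contains213 w) avoids , blocks
  where length≡ = ≡ᵇ⇒≡ (length w) (3 * n) len

inS2-213⁺ : ∀ n w → length w ≡ 3 * n → Valid o₀ w → T (inS2-213 n w)
inS2-213⁺ n w length≡ ((bounded , distinct) , avoids , blocks) =
  ∧-intro (∧-intro (≡⇒≡ᵇ (length w) (3 * n) length≡)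
                   (∧-intro (AllP.all⁻ _ (All.map <⇒<ᵇ (subst (λ m → All (_< m) w) length≡ bounded)))
                            (distinct⁺ w distinct)))
          (∧-intro (T-not⁺ (contains213 w) avoids) blocks)

perms↔trees : ∀ n → S2-213 n ↔ TreeOfSize n
perms↔trees n = mk↔ₛ′ to from to∘from from∘to
  where
  decodeWord : List ℕ → Tree
  decodeWord w = proj₂ (decode o₀ (suc (length w)) w)
  build-decodeWord : ∀ w → Valid o₀ w → build [] (decodeWord w) ≡ w
  build-decodeWord w = build-decode o₀ (suc (length w)) w ≤-refl
  to : S2-213 n → TreeOfSize n
  to (w , p) = decodeWord w , *-cancelˡ-≡ (size (decodeWord w)) n 3 (begin
    3 * size (decodeWord w)            ≡⟨ length-build [] (decodeWord w) ⟨
    length (build [] (decodeWord w))   ≡⟨ cong length (build-decodeWord w (proj₂ (inS2-213⁻ n w p))) ⟩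
    length w                           ≡⟨ proj₁ (inS2-213⁻ n w p) ⟩
    3 * n                              ∎)
    where open ≡-Reasoning
  from : TreeOfSize n → S2-213 n
  from (t , e) = build [] t , inS2-213⁺ n (build [] t) (trans (length-build [] t) (cong (3 *_) e))
                                        (build-valid o₀ [] t empty-valid)
  to∘from : ∀ x → to (from x) ≡ x
  to∘from (t , e) = Σ-size-≡ _ _ (cong proj₂ (decode-build o₀ tt t (suc (length (build [] t))) ≤-refl))
  from∘to : ∀ x → from (to x) ≡ x
  from∘to (w , p) = Σ-T-≡ {P = inS2-213 n} _ _ (build-decodeWord w (proj₂ (inS2-213⁻ n w p)))

theorem11 : (n : ℕ) → S2-213 n ↔ Paths n
theorem11 n = ↔-trans (perms↔trees n) (↔-sym (paths↔trees n))
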